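{- For every finite simple graph $G$, the following statements are equivalent: (i) $G$ is a $2$-probe complete graph; (ii) $G$ is $\{P_4,\ 2K_2,\ K_3+K_1,\ (K_2+K_1)\star 2K_1,\ 2K_1\star 2K_1\star 2K_1\}$-free; (iii) $G$ is a $(K,X,Y,Z)$-graph.
   Context: Graphs are finite and simple. For a graph class $\mathcal{C}$ and an integer $k\ge 1$, a graph $G=(V,E)$ is a $k$-probe $\mathcal{C}$ graph if there exist independent sets $N_1,\dots,N_k\subseteq V$ (possibly empty) and a graph $G'=(V,E')\in\mathcal{C}$ with $E\subseteq E'$ such that for every edge $xy\in E'\setminus E$ there is an $i$ with $x,y\in N_i$. A $2$-probe complete graph is a $2$-probe $\mathcal{C}$ graph where $\mathcal{C}$ is the class of complete graphs. $G+H$ denotes the disjoint union, $2G=G+G$, and the join $G\star H$ is obtained from $G+H$ by adding all edges between a vertex of $G$ and a vertex of $H$. $K_n$ is the complete graph and $P_n$ the path on $n$ vertices. A graph is $\mathcal{F}$-free if it has no induced subgraph isomorphic to a member of $\mathcal{F}$. A vertex is universal if it is adjacent to all other vertices. A graph $G=(V,E)$ is a $(K,X,Y,Z)$-graph if $V$ can be partitioned into disjoint (possibly empty) sets $K,X,Y,Z$ such that $K$ is the set of all universal vertices of $G$, $X\cup Z$ and $Y\cup Z$ are independent sets, and every vertex of $X$ is adjacent to every vertex of $Y$. -}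

module Defs where

open import Level using (Level; 0ℓ; Lift) renaming (suc to lsuc)
open import Data.Nat using (ℕ; zero; suc; _+_)
open import Data.Nat.Properties using (1+n≢n)
open import Data.Fin using (Fin; toℕ; splitAt)
open import Data.Fin.Properties renaming (_≟_ to _≟ᶠ_)
open import Data.Nat.Properties using () renaming (_≟_ to _≟ℕ_)
open import Data.Sum using (_⊎_; inj₁; inj₂)
open import Data.Product using (Σ; ∃; ∃-syntax; _×_; _,_; proj₁; proj₂)
open import Data.Empty using (⊥)
open import Relation.Nullary using (¬_; Dec; yes; no)
open import Relation.Nullary.Decidable using (_⊎-dec_; _×-dec_; ¬?)
open import Relation.Binary.PropositionalEquality using (_≡_; _≢_; refl; sym)
open import Function.Definitions using (Injective)
open import Function.Bundles using (_⇔_)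

record Graph (n : ℕ) : Set₁ where
  field
    Adj     : Fin n → Fin n → Set
    adj?    : ∀ x y → Dec (Adj x y)
    symm    : ∀ {x y} → Adj x y → Adj y x
    irrefl  : ∀ {x} → ¬ Adj x x
open Graph public

Independent : ∀ {n} → Graph n → (Fin n → Set) → Set
Independent G S = ∀ x y → S x → S y → ¬ Adj G x y

GraphClass : Set₂
GraphClass = ∀ {n} → Graph n → Set₁

ProbeGraph : ℕ → GraphClass → ∀ {n} → Graph n → Set₁
ProbeGraph k C {n} G =
  Σ (Fin k → Fin n → Set) λ N →
    (∀ i → Independent G (N i)) ×
    Σ (Graph n) λ G' →
      C G' ×
      (∀ x y → Adj G x y → Adj G' x y) ×
      (∀ x y → Adj G' x y → ¬ Adj G x y → ∃[ i ] (N i x × N i y))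

IsComplete : GraphClass
IsComplete {n} G = Lift (lsuc 0ℓ) (∀ (x y : Fin n) → x ≢ y → Adj G x y)

TwoProbeComplete : ∀ {n} → Graph n → Set₁
TwoProbeComplete = ProbeGraph 2 IsComplete

InducedSub : ∀ {m n} → Graph m → Graph n → Set
InducedSub {m} {n} H G =
  Σ (Fin m → Fin n) λ f →
    Injective _≡_ _≡_ f × (∀ i j → Adj H i j ⇔ Adj G (f i) (f j))

Free : ∀ {m n} → Graph m → Graph n → Set
Free H G = ¬ InducedSub H G

K : (n : ℕ) → Graph n
K n = record
  { Adj = λ x y → x ≢ y
  ; adj? = λ x y → ¬? (x ≟ᶠ y)
  ; symm = λ p q → p (sym q)
  ; irrefl = λ p → p refl
  }

P : (n : ℕ) → Graph n
P n = record
  { Adj = PA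
  ; adj? = λ x y → (toℕ x ≟ℕ suc (toℕ y)) ⊎-dec (toℕ y ≟ℕ suc (toℕ x))
  ; symm = λ { (inj₁ e) → inj₂ e ; (inj₂ e) → inj₁ e }
  ; irrefl = λ { (inj₁ e) → 1+n≢n (sym e) ; (inj₂ e) → 1+n≢n (sym e) }
  }
  where
    PA : Fin n → Fin n → Set
    PA x y = (toℕ x ≡ suc (toℕ y)) ⊎ (toℕ y ≡ suc (toℕ x))

private
  data Cross : Set where none all : Cross

  sumAdj : ∀ {m n} → Cross → Graph m → Graph n →
           Fin m ⊎ Fin n → Fin m ⊎ Fin n → Set
  sumAdj c G H (inj₁ a) (inj₁ b) = Adj G a b
  sumAdj c G H (inj₂ a) (inj₂ b) = Adj H a b
  sumAdj none G H (inj₁ _) (inj₂ _) = ⊥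
  sumAdj none G H (inj₂ _) (inj₁ _) = ⊥
  sumAdj all G H (inj₁ _) (inj₂ _) = Lift0 where open import Data.Unit using () renaming (⊤ to Lift0)
  sumAdj all G H (inj₂ _) (inj₁ _) = Lift0 where open import Data.Unit using () renaming (⊤ to Lift0)

  sumAdj? : ∀ {m n} c (G : Graph m) (H : Graph n) x y → Dec (sumAdj c G H x y)
  sumAdj? c G H (inj₁ a) (inj₁ b) = adj? G a b
  sumAdj? c G H (inj₂ a) (inj₂ b) = adj? H a b
  sumAdj? none G H (inj₁ _) (inj₂ _) = no λ ()
  sumAdj? none G H (inj₂ _) (inj₁ _) = no λ ()
  sumAdj? all G H (inj₁ _) (inj₂ _) = yes _
  sumAdj? all G H (inj₂ _) (inj₁ _) = yes _

  sumSym : ∀ {m n} c (G : Graph m) (H : Graph n) x y →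
           sumAdj c G H x y → sumAdj c G H y x
  sumSym c G H (inj₁ a) (inj₁ b) p = symm G p
  sumSym c G H (inj₂ a) (inj₂ b) p = symm H p
  sumSym all G H (inj₁ _) (inj₂ _) p = _
  sumSym all G H (inj₂ _) (inj₁ _) p = _

  sumIrr : ∀ {m n} c (G : Graph m) (H : Graph n) x → ¬ sumAdj c G H x x
  sumIrr c G H (inj₁ a) = irrefl G
  sumIrr c G H (inj₂ a) = irrefl H

  combine : ∀ {m n} → Cross → Graph m → Graph n → Graph (m + n)
  combine {m} c G H = record
    { Adj = λ x y → sumAdj c G H (splitAt m x) (splitAt m y)
    ; adj? = λ x y → sumAdj? c G H (splitAt m x) (splitAt m y)
    ; symm = λ {x} {y} → sumSym c G H (splitAt m x) (splitAt m y)
    ; irrefl = λ {x} → sumIrr c G H (splitAt m x)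
    }

infixl 6 _⊕_
_⊕_ : ∀ {m n} → Graph m → Graph n → Graph (m + n)
_⊕_ = combine none

infixl 5 _⋆_
_⋆_ : ∀ {m n} → Graph m → Graph n → Graph (m + n)
_⋆_ = combine all

twice : ∀ {n} → Graph n → Graph (n + n)
twice G = G ⊕ G

Universal : ∀ {n} → Graph n → Fin n → Set
Universal G v = ∀ w → w ≢ v → Adj G v w

data Part : Set where
  pK pX pY pZ : Part

KXYZGraph : ∀ {n} → Graph n → Set
KXYZGraph {n} G =
  Σ (Fin n → Part) λ ℓ →
    (∀ v → (ℓ v ≡ pK) ⇔ Universal G v) ×
    Independent G (λ v → (ℓ v ≡ pX) ⊎ (ℓ v ≡ pZ)) ×
    Independent G (λ v → (ℓ v ≡ pY) ⊎ (ℓ v ≡ pZ)) ×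
    (∀ x y → ℓ x ≡ pX → ℓ y ≡ pY → Adj G x y)

ForbiddenFree : ∀ {n} → Graph n → Set
ForbiddenFree G =
  Free (P 4) G ×
  Free (twice (K 2)) G ×
  Free (K 3 ⊕ K 1) G ×
  Free ((K 2 ⊕ K 1) ⋆ twice (K 1)) G ×
  Free (twice (K 1) ⋆ twice (K 1) ⋆ twice (K 1)) G

-- (i) ⇒ (ii): 2-probe completeness is inherited by induced subgraphs, and each
-- forbidden graph has three non-edges that pairwise touch along an edge, so the
-- probe sets containing them would have to be pairwise distinct, of which there
-- are only two.
-- (ii) ⇒ (iii): call a vertex active if it is non-universal with a non-universal
-- neighbour. The forbidden graphs force both the non-neighbourhood and the active
-- neighbourhood of an active vertex to be independent. Hence, for a fixed active
-- x₀, the active non-neighbours (X, including x₀) and active neighbours (Y) of x₀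
-- form a complete bipartite graph, and every other non-universal vertex (Z) is
-- isolated in G − K.
-- (iii) ⇒ (i): take N₁ = X ∪ Z, N₂ = Y ∪ Z and the complete graph.
module Submission where

open import Defs
open import Data.Nat using (ℕ; zero; suc)
open import Data.Fin using (Fin; zero; suc; #_)
open import Data.Fin.Properties using (_≟_; any?)
open import Data.Vec using (Vec; []; _∷_; lookup)
open import Data.Product using (∃; _×_; _,_; proj₁; proj₂)
open import Data.Sum using (_⊎_; inj₁; inj₂)
open import Data.Empty using (⊥; ⊥-elim)
open import Data.Unit using (⊤; tt)
open import Function using (_∘_; case_of_)
open import Function.Bundles using (_⇔_; mk⇔; Equivalence)
open import Level using (lift)
open import Relation.Nullary using (¬_; Dec; yes; no)
open import Relation.Nullary.Decidable
  using (True; False; map′; toWitness; toWitnessFalse; decidable-stable; ¬?; _×-dec_; _⊎-dec_)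
open import Relation.Binary.PropositionalEquality using (_≡_; _≢_; refl; cong; ≢-sym)

module GraphNotation {n} (G : Graph n) where

  infix 4 _∼_ _≁_

  _∼_ : Fin n → Fin n → Set
  x ∼ y = Adj G x y

  _≁_ : Fin n → Fin n → Set
  x ≁ y = x ≢ y × ¬ x ∼ y

  ∼-sym : ∀ {x y} → x ∼ y → y ∼ x
  ∼-sym = symm G

  ≁-sym : ∀ {x y} → x ≁ y → y ≁ x
  ≁-sym (x≢y , ¬xy) = ≢-sym x≢y , ¬xy ∘ ∼-sym

  ∼⇒≢ : ∀ {x y} → x ∼ y → x ≢ y
  ∼⇒≢ xy refl = irrefl G xy

  ≁-by : ∀ {p x y} → p ∼ x → ¬ p ∼ y → ¬ x ∼ y → x ≁ y
  ≁-by px ¬py ¬xy = (λ { refl → ¬py px }) , ¬xy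

-- (i) ⇒ (ii)

probeComplete-induced : ∀ {k m n} {H : Graph m} {G : Graph n} →
  InducedSub H G → ProbeGraph k IsComplete G → ProbeGraph k IsComplete H
probeComplete-induced {m = m} {H = H} (f , f-inj , f-iso)
                      (N , N-independent , _ , lift complete , _ , cover) =
  (λ i → N i ∘ f) , independent , K m , lift (λ _ _ x≢y → x≢y) ,
  (λ _ _ → GraphNotation.∼⇒≢ H) , cover′
  where
    independent : ∀ i → Independent H (N i ∘ f)
    independent i x y Nx Ny xy = N-independent i _ _ Nx Ny (Equivalence.to (f-iso x y) xy)

    cover′ : ∀ x y → x ≢ y → ¬ Adj H x y → ∃ λ i → N i (f x) × N i (f y)
    cover′ x y x≢y ¬xy =
      cover _ _ (complete _ _ (x≢y ∘ f-inj)) (¬xy ∘ Equivalence.from (f-iso x y))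

pigeonhole-Fin2 : (i j k : Fin 2) → i ≢ j → j ≢ k → i ≢ k → ⊥
pigeonhole-Fin2 zero       zero       _          i≢j _   _   = i≢j refl
pigeonhole-Fin2 (suc zero) (suc zero) _          i≢j _   _   = i≢j refl
pigeonhole-Fin2 zero       (suc zero) zero       _   _   i≢k = i≢k refl
pigeonhole-Fin2 zero       (suc zero) (suc zero) _   j≢k _   = j≢k refl
pigeonhole-Fin2 (suc zero) zero       zero       _   j≢k _   = j≢k refl
pigeonhole-Fin2 (suc zero) zero       (suc zero) _   _   i≢k = i≢k refl

record NonEdge {m} (H : Graph m) : Set where
  field
    end₁ end₂   : Fin m
    distinct    : end₁ ≢ end₂
    nonAdjacent : ¬ Adj H end₁ end₂
open NonEdge

nonEdge : ∀ {m} {H : Graph m} (x y : Fin m) →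
  {False (x ≟ y)} → {False (adj? H x y)} → NonEdge H
nonEdge x y {x≢y} {¬xy} = record
  { end₁ = x ; end₂ = y
  ; distinct = toWitnessFalse x≢y ; nonAdjacent = toWitnessFalse ¬xy }

module _ {m} (H : Graph m) where

  record Touches (e e′ : NonEdge H) : Set where
    constructor touching
    field
      edge : (Adj H (end₁ e) (end₁ e′) ⊎ Adj H (end₁ e) (end₂ e′))
           ⊎ (Adj H (end₂ e) (end₁ e′) ⊎ Adj H (end₂ e) (end₂ e′))

  touches? : ∀ e e′ → Dec (Touches e e′)
  touches? e e′ = map′ touching Touches.edge
    ((adj? H _ _ ⊎-dec adj? H _ _) ⊎-dec (adj? H _ _ ⊎-dec adj? H _ _))

  touchingTriangle⇒¬twoProbeComplete : (e₁ e₂ e₃ : NonEdge H) →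
    Touches e₁ e₂ → Touches e₂ e₃ → Touches e₁ e₃ → ¬ TwoProbeComplete H
  touchingTriangle⇒¬twoProbeComplete e₁ e₂ e₃ t₁₂ t₂₃ t₁₃
                                     (N , N-independent , _ , lift complete , _ , cover) =
    pigeonhole-Fin2 _ _ _ (colours-differ t₁₂) (colours-differ t₂₃) (colours-differ t₁₃)
    where
      Colouring : NonEdge H → Set
      Colouring e = ∃ λ i → N i (end₁ e) × N i (end₂ e)

      colour : ∀ e → Colouring e
      colour e = cover _ _ (complete _ _ (distinct e)) (nonAdjacent e)

      clash : ∀ {i j x y} → N i x → N j y → Adj H x y → i ≢ j
      clash {i} Nx Ny xy refl = N-independent i _ _ Nx Ny xy

      colours-differ : ∀ {e e′} → Touches e e′ → proj₁ (colour e) ≢ proj₁ (colour e′)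
      colours-differ {e} {e′} (touching t) with colour e | colour e′
      ... | _ , N₁ , N₂ | _ , N₁′ , N₂′ with t
      ...   | inj₁ (inj₁ xy) = clash N₁ N₁′ xy
      ...   | inj₁ (inj₂ xy) = clash N₁ N₂′ xy
      ...   | inj₂ (inj₁ xy) = clash N₂ N₁′ xy
      ...   | inj₂ (inj₂ xy) = clash N₂ N₂′ xy

touch : ∀ {m} {H : Graph m} {e e′ : NonEdge H} →
  {t : True (touches? H e e′)} → Touches H e e′
touch {t = t} = toWitness t

P₄-¬twoProbeComplete : ¬ TwoProbeComplete (P 4)
P₄-¬twoProbeComplete = touchingTriangle⇒¬twoProbeComplete (P 4)
  (nonEdge (# 0) (# 2)) (nonEdge (# 0) (# 3)) (nonEdge (# 1) (# 3)) touch touch touch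

2K₂-¬twoProbeComplete : ¬ TwoProbeComplete (twice (K 2))
2K₂-¬twoProbeComplete = touchingTriangle⇒¬twoProbeComplete (twice (K 2))
  (nonEdge (# 0) (# 2)) (nonEdge (# 1) (# 3)) (nonEdge (# 0) (# 3)) touch touch touch

K₃+K₁-¬twoProbeComplete : ¬ TwoProbeComplete (K 3 ⊕ K 1)
K₃+K₁-¬twoProbeComplete = touchingTriangle⇒¬twoProbeComplete (K 3 ⊕ K 1)
  (nonEdge (# 0) (# 3)) (nonEdge (# 1) (# 3)) (nonEdge (# 2) (# 3)) touch touch touch

K₂+K₁⋆2K₁-¬twoProbeComplete : ¬ TwoProbeComplete ((K 2 ⊕ K 1) ⋆ twice (K 1))
K₂+K₁⋆2K₁-¬twoProbeComplete = touchingTriangle⇒¬twoProbeComplete ((K 2 ⊕ K 1) ⋆ twice (K 1))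
  (nonEdge (# 0) (# 2)) (nonEdge (# 1) (# 2)) (nonEdge (# 3) (# 4)) touch touch touch

2K₁⋆2K₁⋆2K₁-¬twoProbeComplete : ¬ TwoProbeComplete (twice (K 1) ⋆ twice (K 1) ⋆ twice (K 1))
2K₁⋆2K₁⋆2K₁-¬twoProbeComplete = touchingTriangle⇒¬twoProbeComplete (twice (K 1) ⋆ twice (K 1) ⋆ twice (K 1))
  (nonEdge (# 0) (# 1)) (nonEdge (# 2) (# 3)) (nonEdge (# 4) (# 5)) touch touch touch

twoProbeComplete⇒forbiddenFree : ∀ {n} {G : Graph n} → TwoProbeComplete G → ForbiddenFree G
twoProbeComplete⇒forbiddenFree {G = G} pc =
  excluded (P 4) P₄-¬twoProbeComplete ,
  excluded (twice (K 2)) 2K₂-¬twoProbeComplete ,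
  excluded (K 3 ⊕ K 1) K₃+K₁-¬twoProbeComplete ,
  excluded ((K 2 ⊕ K 1) ⋆ twice (K 1)) K₂+K₁⋆2K₁-¬twoProbeComplete ,
  excluded (twice (K 1) ⋆ twice (K 1) ⋆ twice (K 1)) 2K₁⋆2K₁⋆2K₁-¬twoProbeComplete
  where
    excluded : ∀ {m} (H : Graph m) → ¬ TwoProbeComplete H → Free H G
    excluded H ¬pc H↪G = ¬pc (probeComplete-induced {H = H} {G = G} H↪G pc)

-- (ii) ⇒ (iii)

module Activity {n} (G : Graph n) where
  open GraphNotation G

  NonUniversal : Fin n → Set
  NonUniversal v = ∃ (v ≁_)

  nonUniversal? : ∀ v → Dec (NonUniversal v)
  nonUniversal? v = any? λ t → ¬? (v ≟ t) ×-dec ¬? (adj? G v t)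

  ¬nonUniversal⇒universal : ∀ {v} → ¬ NonUniversal v → Universal G v
  ¬nonUniversal⇒universal {v} ¬nu w w≢v =
    decidable-stable (adj? G v w) λ ¬vw → ¬nu (w , ≢-sym w≢v , ¬vw)

  universal⇒¬nonUniversal : ∀ {v} → Universal G v → ¬ NonUniversal v
  universal⇒¬nonUniversal u (t , v≢t , ¬vt) = ¬vt (u t (≢-sym v≢t))

  Active : Fin n → Set
  Active v = NonUniversal v × ∃ λ u → NonUniversal u × v ∼ u

  active? : ∀ v → Dec (Active v)
  active? v = nonUniversal? v ×-dec any? λ u → nonUniversal? u ×-dec adj? G v u

  -- isolated in G − K, K being the set of universal vertices
  Isolated : Fin n → Set
  Isolated v = ∀ {u} → NonUniversal u → ¬ v ∼ u

  nonUniversal⇒active⊎isolated : ∀ {v} → NonUniversal v → Active v ⊎ Isolated v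
  nonUniversal⇒active⊎isolated {v} nu with any? (λ u → nonUniversal? u ×-dec adj? G v u)
  ... | yes nbr = inj₁ (nu , nbr)
  ... | no ¬nbr = inj₂ λ nuu vu → ¬nbr (_ , nuu , vu)

  isolated-independent : ∀ {P : Fin n → Set} →
    (∀ {v} → P v → NonUniversal v) → (∀ {x y} → P x → P y → ¬ x ∼ y) →
    Independent G (λ v → P v ⊎ NonUniversal v × Isolated v)
  isolated-independent nu P-indep x y (inj₁ Px)        (inj₁ Py)         = P-indep Px Py
  isolated-independent nu P-indep x y (inj₂ (_ , iso)) (inj₁ Py)         = iso (nu Py)
  isolated-independent nu P-indep x y (inj₂ (_ , iso)) (inj₂ (nuy , _))  = iso nuy
  isolated-independent nu P-indep x y (inj₁ Px)        (inj₂ (_ , iso))  = iso (nu Px) ∘ ∼-sym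

  module Bipartition {S : Fin n → Set} (S? : ∀ v → Dec (S v))
    (S-independent  : ∀ {x y} → Active x → Active y → S x → S y → ¬ x ∼ y)
    (∁S-independent : ∀ {x y} → Active x → Active y → ¬ S x → ¬ S y → ¬ x ∼ y)
    (S-∁S-complete  : ∀ {x y} → Active x → Active y → S x → ¬ S y → x ∼ y)
    where

    data Role (v : Fin n) : Part → Set where
      universal : Universal G v → Role v pK
      left      : Active v → S v → Role v pX
      right     : Active v → ¬ S v → Role v pY
      isolated  : NonUniversal v → Isolated v → Role v pZ

    role : ∀ v → ∃ (Role v)
    role v with nonUniversal? v
    ... | no ¬nu = pK , universal (¬nonUniversal⇒universal ¬nu)
    ... | yes nu with nonUniversal⇒active⊎isolated nu | S? v
    ...   | inj₁ act | yes s = pX , left act s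
    ...   | inj₁ act | no ¬s = pY , right act ¬s
    ...   | inj₂ iso | _     = pZ , isolated nu iso

    ℓ : Fin n → Part
    ℓ = proj₁ ∘ role

    roleAt : ∀ {v p} → ℓ v ≡ p → Role v p
    roleAt {v} refl = proj₂ (role v)

    universal-role : ∀ {v p} → Role v p → Universal G v → p ≡ pK
    universal-role (universal _)    _ = refl
    universal-role (left act _)     u = ⊥-elim (universal⇒¬nonUniversal u (proj₁ act))
    universal-role (right act _)    u = ⊥-elim (universal⇒¬nonUniversal u (proj₁ act))
    universal-role (isolated nu _)  u = ⊥-elim (universal⇒¬nonUniversal u nu)

    K-universal : ∀ v → (ℓ v ≡ pK) ⇔ Universal G v
    K-universal v = mk⇔ (λ e → fromK (roleAt e)) (universal-role (proj₂ (role v)))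
      where
        fromK : Role v pK → Universal G v
        fromK (universal u) = u

    fromX : ∀ {v} → Role v pX → Active v × S v
    fromX (left act s) = act , s

    fromY : ∀ {v} → Role v pY → Active v × ¬ S v
    fromY (right act ¬s) = act , ¬s

    fromZ : ∀ {v} → Role v pZ → NonUniversal v × Isolated v
    fromZ (isolated nu iso) = nu , iso

    X∪Z-independent : Independent G (λ v → (ℓ v ≡ pX) ⊎ (ℓ v ≡ pZ))
    X∪Z-independent x y Lx Ly =
      isolated-independent (proj₁ ∘ proj₁) (λ (ax , sx) (ay , sy) → S-independent ax ay sx sy)
        x y (role-X∪Z Lx) (role-X∪Z Ly)
      where
        role-X∪Z : ∀ {v} → (ℓ v ≡ pX) ⊎ (ℓ v ≡ pZ) →
                   (Active v × S v) ⊎ (NonUniversal v × Isolated v)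
        role-X∪Z (inj₁ e) = inj₁ (fromX (roleAt e))
        role-X∪Z (inj₂ e) = inj₂ (fromZ (roleAt e))

    Y∪Z-independent : Independent G (λ v → (ℓ v ≡ pY) ⊎ (ℓ v ≡ pZ))
    Y∪Z-independent x y Lx Ly =
      isolated-independent (proj₁ ∘ proj₁) (λ (ax , sx) (ay , sy) → ∁S-independent ax ay sx sy)
        x y (role-Y∪Z Lx) (role-Y∪Z Ly)
      where
        role-Y∪Z : ∀ {v} → (ℓ v ≡ pY) ⊎ (ℓ v ≡ pZ) →
                   (Active v × ¬ S v) ⊎ (NonUniversal v × Isolated v)
        role-Y∪Z (inj₁ e) = inj₁ (fromY (roleAt e))
        role-Y∪Z (inj₂ e) = inj₂ (fromZ (roleAt e))

    X-Y-complete : ∀ x y → ℓ x ≡ pX → ℓ y ≡ pY → x ∼ y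
    X-Y-complete x y Lx Ly with fromX (roleAt Lx) | fromY (roleAt Ly)
    ... | ax , sx | ay , ¬sy = S-∁S-complete ax ay sx ¬sy

    kxyz : KXYZGraph G
    kxyz = ℓ , K-universal , X∪Z-independent , Y∪Z-independent , X-Y-complete

module Embedding {n} (G : Graph n) where
  open GraphNotation G

  Row : ∀ m → (Fin m → Set) → Set → Set
  Row zero    P R = R
  Row (suc m) P R = P zero × Row m (P ∘ suc) R

  row-lookup : ∀ {m P R} → Row m P R → ∀ j → P j
  row-lookup (p , _)  zero    = p
  row-lookup (_ , ps) (suc j) = row-lookup ps j

  row-rest : ∀ {m P R} → Row m P R → R
  row-rest {zero}  r        = r
  row-rest {suc m} (_ , ps) = row-rest ps

  withoutFirst : ∀ {m} → Graph (suc m) → Graph m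
  withoutFirst H = record
    { Adj = λ i j → Adj H (suc i) (suc j)
    ; adj? = λ i j → adj? H (suc i) (suc j)
    ; symm = symm H
    ; irrefl = irrefl H
    }

  Fact : ∀ {A : Set} → Dec A → Fin n → Fin n → Set
  Fact (yes _) x y = x ∼ y
  Fact (no _)  x y = x ≁ y

  -- The facts for all pairs i < j, in lexicographic order, as one tuple ending in tt.
  Realises : ∀ {m} → Graph m → (Fin m → Fin n) → Set
  Realises {zero}  H f = ⊤
  Realises {suc m} H f = Row m (λ j → Fact (adj? H zero (suc j)) (f zero) (f (suc j)))
                               (Realises (withoutFirst H) (f ∘ suc))

  Mirrors : ∀ {m} → Graph m → (Fin m → Fin n) → Fin m → Fin m → Set
  Mirrors H f i j = (Adj H i j ⇔ f i ∼ f j) × (i ≢ j → f i ≢ f j)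

  fact⇒mirrors : ∀ {m} (H : Graph m) f i j → Fact (adj? H i j) (f i) (f j) → Mirrors H f i j
  fact⇒mirrors H f i j fact with adj? H i j
  ... | yes Hij = mk⇔ (λ _ → fact) (λ _ → Hij) , λ _ → ∼⇒≢ fact
  ... | no ¬Hij = mk⇔ (⊥-elim ∘ ¬Hij) (⊥-elim ∘ proj₂ fact) , λ _ → proj₁ fact

  mirrors-sym : ∀ {m} (H : Graph m) f {i j} → Mirrors H f i j → Mirrors H f j i
  mirrors-sym H f (iso , inj) =
    mk⇔ (∼-sym ∘ Equivalence.to iso ∘ symm H) (symm H ∘ Equivalence.from iso ∘ ∼-sym) ,
    λ j≢i → ≢-sym (inj (≢-sym j≢i))

  realises⇒mirrors : ∀ {m} (H : Graph m) f → Realises H f → ∀ i j → Mirrors H f i j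
  realises⇒mirrors H f _ zero zero =
    mk⇔ (⊥-elim ∘ irrefl H) (⊥-elim ∘ irrefl G) , λ 0≢0 → ⊥-elim (0≢0 refl)
  realises⇒mirrors H f facts zero (suc j) =
    fact⇒mirrors H f zero (suc j) (row-lookup facts j)
  realises⇒mirrors H f facts (suc i) zero =
    mirrors-sym H f (fact⇒mirrors H f zero (suc i) (row-lookup facts i))
  realises⇒mirrors H f facts (suc i) (suc j) =
    let iso , inj = realises⇒mirrors (withoutFirst H) (f ∘ suc) (row-rest facts) i j
    in iso , inj ∘ (_∘ cong suc)

  inducedBy : ∀ {m} (H : Graph m) (vs : Vec (Fin n) m) → Realises H (lookup vs) → InducedSub H G
  inducedBy H vs facts = lookup vs , injective , λ i j → proj₁ (mirrors i j)
    where
      mirrors : ∀ i j → Mirrors H (lookup vs) i j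
      mirrors = realises⇒mirrors H (lookup vs) facts

      injective : ∀ {i j} → lookup vs i ≡ lookup vs j → i ≡ j
      injective {i} {j} eq with i ≟ j
      ... | yes i≡j = i≡j
      ... | no  i≢j = ⊥-elim (proj₂ (mirrors i j) i≢j eq)

module ForbiddenFreeStructure {n} {G : Graph n}
  (P₄-free         : Free (P 4) G)
  (2K₂-free        : Free (twice (K 2)) G)
  (K₃+K₁-free      : Free (K 3 ⊕ K 1) G)
  (K₂+K₁⋆2K₁-free  : Free ((K 2 ⊕ K 1) ⋆ twice (K 1)) G)
  (2K₁⋆2K₁⋆2K₁-free : Free (twice (K 1) ⋆ twice (K 1) ⋆ twice (K 1)) G)
  where
  open GraphNotation G
  open Activity G
  open Embedding G

  neighbour-sees-anticompleteEdge : ∀ {a w u v} →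
    a ∼ w → u ∼ v → a ≁ u → a ≁ v → w ∼ u
  neighbour-sees-anticompleteEdge {a} {w} {u} {v} aw uv a≁u a≁v with adj? G w u | adj? G w v
  ... | yes wu | _ = wu
  ... | no ¬wu | no ¬wv = ⊥-elim (2K₂-free (inducedBy (twice (K 2)) (u ∷ v ∷ a ∷ w ∷ [])
          (uv , ≁-sym a≁u , ≁-sym w≁u , ≁-sym a≁v , ≁-sym w≁v , aw , tt)))
    where
      w≁u : w ≁ u
      w≁u = ≁-by aw (proj₂ a≁u) ¬wu
      w≁v : w ≁ v
      w≁v = ≁-by aw (proj₂ a≁v) ¬wv
  ... | no ¬wu | yes wv = ⊥-elim (P₄-free (inducedBy (P 4) (a ∷ w ∷ v ∷ u ∷ [])
          (aw , a≁v , a≁u , wv , ≁-by aw (proj₂ a≁u) ¬wu , ∼-sym uv , tt)))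

  nonNeighbour-sees-anticompleteEdge : ∀ {a w u v t} →
    w ∼ a → w ∼ u → w ∼ v → u ∼ v → a ≁ u → a ≁ v → t ≁ w → t ≁ a → t ∼ u
  nonNeighbour-sees-anticompleteEdge {a} {w} {u} {v} {t} wa wu wv uv a≁u a≁v t≁w t≁a
    with adj? G t u | adj? G t v
  ... | yes tu | _ = tu
  ... | no ¬tu | yes tv = ⊥-elim (P₄-free (inducedBy (P 4) (t ∷ v ∷ w ∷ a ∷ [])
          (tv , t≁w , t≁a , ∼-sym wv , ≁-sym a≁v , wa , tt)))
  ... | no ¬tu | no ¬tv = ⊥-elim (K₃+K₁-free (inducedBy (K 3 ⊕ K 1) (w ∷ u ∷ v ∷ t ∷ [])
          (wu , wv , ≁-sym t≁w , uv , u≁t , v≁t , tt)))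
    where
      u≁t : u ≁ t
      u≁t = ≁-by wu (proj₂ (≁-sym t≁w)) (¬tu ∘ ∼-sym)
      v≁t : v ≁ t
      v≁t = ≁-by wv (proj₂ (≁-sym t≁w)) (¬tv ∘ ∼-sym)

  nonNeighbours-of-active-independent : ∀ {a u v} → Active a → a ≁ u → a ≁ v → ¬ u ∼ v
  nonNeighbours-of-active-independent {a} {u} {v} (_ , w , (t , w≁t) , aw) a≁u a≁v uv =
    case adj? G t a of λ where
      (yes ta) →
        let tu = neighbour-sees-anticompleteEdge (∼-sym ta) uv a≁u a≁v
            tv = neighbour-sees-anticompleteEdge (∼-sym ta) (∼-sym uv) a≁v a≁u
        in K₂+K₁⋆2K₁-free (inducedBy ((K 2 ⊕ K 1) ⋆ twice (K 1)) (u ∷ v ∷ a ∷ w ∷ t ∷ [])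
             (uv , ≁-sym a≁u , ∼-sym wu , ∼-sym tu , ≁-sym a≁v , ∼-sym wv , ∼-sym tv ,
              aw , ∼-sym ta , w≁t , tt))
      (no ¬ta) →
        let a≁t = ≁-by (∼-sym aw) (proj₂ w≁t) (¬ta ∘ ∼-sym)
            tu = nonNeighbour-sees-anticompleteEdge
                   (∼-sym aw) wu wv uv a≁u a≁v (≁-sym w≁t) (≁-sym a≁t)
            tv = nonNeighbour-sees-anticompleteEdge
                   (∼-sym aw) wv wu (∼-sym uv) a≁v a≁u (≁-sym w≁t) (≁-sym a≁t)
        in K₃+K₁-free (inducedBy (K 3 ⊕ K 1) (u ∷ v ∷ t ∷ a ∷ [])
             (uv , ∼-sym tu , ≁-sym a≁u , ∼-sym tv , ≁-sym a≁v , ≁-sym a≁t , tt))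
    where
      wu : w ∼ u
      wu = neighbour-sees-anticompleteEdge aw uv a≁u a≁v
      wv : w ∼ v
      wv = neighbour-sees-anticompleteEdge aw (∼-sym uv) a≁v a≁u

  active-sees-neighboursOfNonNeighbours : ∀ {a p q} → Active a → a ≁ p → p ∼ q → a ∼ q
  active-sees-neighboursOfNonNeighbours {a} {p} {q} act a≁p pq with adj? G a q
  ... | yes aq = aq
  ... | no ¬aq = ⊥-elim (nonNeighbours-of-active-independent act a≁p a≁q pq)
    where
      a≁q : a ≁ q
      a≁q = ≁-sym (≁-by pq (proj₂ (≁-sym a≁p)) (¬aq ∘ ∼-sym))

  nonNeighbour-of-triangle-active : ∀ {x y z b} →
    NonUniversal y → NonUniversal z → x ∼ y → x ∼ z → y ∼ z → x ≁ b → Active b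
  nonNeighbour-of-triangle-active {x} {y} {z} {b} nuy nuz xy xz yz x≁b
    with nonUniversal⇒active⊎isolated (x , ≁-sym x≁b)
  ... | inj₁ act = act
  ... | inj₂ iso = ⊥-elim (K₃+K₁-free (inducedBy (K 3 ⊕ K 1) (x ∷ y ∷ z ∷ b ∷ [])
          (xy , xz , x≁b , yz , y≁b , z≁b , tt)))
    where
      y≁b : y ≁ b
      y≁b = ≁-by xy (proj₂ x≁b) (iso nuy ∘ ∼-sym)
      z≁b : z ≁ b
      z≁b = ≁-by xz (proj₂ x≁b) (iso nuz ∘ ∼-sym)

  activeNeighbours-independent : ∀ {x y z} → Active x → Active y → Active z →
    x ∼ y → x ∼ z → ¬ y ∼ z
  activeNeighbours-independent {x} {y} {z} ((a , x≁a) , _) ((b , y≁b) , _) ((c , z≁c) , _)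
                               xy xz yz =
    2K₁⋆2K₁⋆2K₁-free (inducedBy (twice (K 1) ⋆ twice (K 1) ⋆ twice (K 1))
      (x ∷ a ∷ y ∷ b ∷ z ∷ c ∷ [])
      (x≁a , xy , xb , xz , xc ,
       a∼ xy , a∼ xb , a∼ xz , a∼ xc ,
       y≁b , yz , yc ,
       b∼ yz , b∼ yc ,
       z≁c , tt))
    where
      nux : NonUniversal x
      nux = a , x≁a
      nuy : NonUniversal y
      nuy = b , y≁b
      nuz : NonUniversal z
      nuz = c , z≁c
      a∼ : ∀ {q} → x ∼ q → a ∼ q
      a∼ = active-sees-neighboursOfNonNeighbours
             (nonNeighbour-of-triangle-active nuy nuz xy xz yz x≁a) (≁-sym x≁a)
      b∼ : ∀ {q} → y ∼ q → b ∼ q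
      b∼ = active-sees-neighboursOfNonNeighbours
             (nonNeighbour-of-triangle-active nux nuz (∼-sym xy) yz xz y≁b) (≁-sym y≁b)
      c∼ : ∀ {q} → z ∼ q → c ∼ q
      c∼ = active-sees-neighboursOfNonNeighbours
             (nonNeighbour-of-triangle-active nux nuy (∼-sym xz) (∼-sym yz) xy z≁c) (≁-sym z≁c)
      xb : x ∼ b
      xb = ∼-sym (b∼ (∼-sym xy))
      xc : x ∼ c
      xc = ∼-sym (c∼ (∼-sym xz))
      yc : y ∼ c
      yc = ∼-sym (c∼ (∼-sym yz))

  kxyz : KXYZGraph G
  kxyz with any? active?
  ... | no ¬active = Bipartition.kxyz {S = λ _ → ⊤} (λ _ → yes tt)
    (⊥-elim ∘ inactive) (⊥-elim ∘ inactive) (⊥-elim ∘ inactive)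
    where
      inactive : ∀ {x} → ¬ Active x
      inactive ax = ¬active (_ , ax)
  ... | yes (x₀ , a₀) =
    Bipartition.kxyz {S = λ v → ¬ x₀ ∼ v} (λ v → ¬? (adj? G x₀ v))
      X-independent Y-independent X-Y-complete
    where
      X-independent : ∀ {x y} → Active x → Active y → ¬ x₀ ∼ x → ¬ x₀ ∼ y → ¬ x ∼ y
      X-independent {x} {y} _ _ ¬x₀x ¬x₀y xy with x ≟ x₀ | y ≟ x₀
      ... | yes refl | _        = ¬x₀y xy
      ... | no _     | yes refl = ¬x₀x (∼-sym xy)
      ... | no x≢x₀  | no y≢x₀  =
        nonNeighbours-of-active-independent a₀ (≢-sym x≢x₀ , ¬x₀x) (≢-sym y≢x₀ , ¬x₀y) xy

      neighbour : ∀ {y} → ¬ ¬ x₀ ∼ y → x₀ ∼ y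
      neighbour = decidable-stable (adj? G _ _)

      Y-independent : ∀ {x y} → Active x → Active y → ¬ ¬ x₀ ∼ x → ¬ ¬ x₀ ∼ y → ¬ x ∼ y
      Y-independent ax ay x₀x x₀y =
        activeNeighbours-independent a₀ ax ay (neighbour x₀x) (neighbour x₀y)

      X-Y-complete : ∀ {x y} → Active x → Active y → ¬ x₀ ∼ x → ¬ ¬ x₀ ∼ y → x ∼ y
      X-Y-complete {x} ax _ ¬x₀x x₀y with x ≟ x₀
      ... | yes refl = neighbour x₀y
      ... | no x≢x₀  =
        active-sees-neighboursOfNonNeighbours ax (x≢x₀ , ¬x₀x ∘ ∼-sym) (neighbour x₀y)

forbiddenFree⇒kxyz : ∀ {n} {G : Graph n} → ForbiddenFree G → KXYZGraph G
forbiddenFree⇒kxyz {G = G} (P₄-free , 2K₂-free , K₃+K₁-free , K₂+K₁⋆2K₁-free , 2K₁⋆2K₁⋆2K₁-free) =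
  ForbiddenFreeStructure.kxyz {G = G} P₄-free 2K₂-free K₃+K₁-free K₂+K₁⋆2K₁-free 2K₁⋆2K₁⋆2K₁-free

-- (iii) ⇒ (i)

kxyz⇒twoProbeComplete : ∀ {n} {G : Graph n} → KXYZGraph G → TwoProbeComplete G
kxyz⇒twoProbeComplete {n} {G}
  (ℓ , K-universal , X∪Z-independent , Y∪Z-independent , X-Y-complete) =
  N , N-independent , K n , lift (λ _ _ x≢y → x≢y) , (λ _ _ → ∼⇒≢) , cover
  where
    open GraphNotation G

    N : Fin 2 → Fin n → Set
    N zero    v = (ℓ v ≡ pX) ⊎ (ℓ v ≡ pZ)
    N (suc _) v = (ℓ v ≡ pY) ⊎ (ℓ v ≡ pZ)

    N-independent : ∀ i → Independent G (N i)
    N-independent zero       = X∪Z-independent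
    N-independent (suc zero) = Y∪Z-independent

    universal : ∀ {v} → ℓ v ≡ pK → Universal G v
    universal {v} = Equivalence.to (K-universal v)

    cover : ∀ x y → x ≢ y → ¬ x ∼ y → ∃ λ i → N i x × N i y
    cover x y x≢y ¬xy with ℓ x in Lx | ℓ y in Ly
    ... | pK | _  = ⊥-elim (¬xy (universal Lx y (≢-sym x≢y)))
    ... | _  | pK = ⊥-elim (¬xy (∼-sym (universal Ly x x≢y)))
    ... | pX | pY = ⊥-elim (¬xy (X-Y-complete x y Lx Ly))
    ... | pY | pX = ⊥-elim (¬xy (∼-sym (X-Y-complete y x Ly Lx)))
    ... | pX | pX = zero , inj₁ Lx , inj₁ Ly
    ... | pX | pZ = zero , inj₁ Lx , inj₂ Ly
    ... | pZ | pX = zero , inj₂ Lx , inj₁ Ly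
    ... | pZ | pZ = zero , inj₂ Lx , inj₂ Ly
    ... | pY | pY = suc zero , inj₁ Lx , inj₁ Ly
    ... | pY | pZ = suc zero , inj₁ Lx , inj₂ Ly
    ... | pZ | pY = suc zero , inj₂ Lx , inj₁ Ly

theorem4 : ∀ {n : ℕ} (G : Graph n) →
    (TwoProbeComplete G → ForbiddenFree G) ×
    (ForbiddenFree G → KXYZGraph G) ×
    (KXYZGraph G → TwoProbeComplete G)
theorem4 G =
  twoProbeComplete⇒forbiddenFree {G = G} ,
  forbiddenFree⇒kxyz {G = G} ,
  kxyz⇒twoProbeComplete {G = G}
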